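{- Let $\mathcal M=(M,\le,{}^\perp)$ be a complete orthomodular lattice, let $L$ be an involutive submonoid of $\mathbf{Lin}(\mathcal M)$ containing all Sasaki projections $\pi_m$ ($m\in M$), and let $A\in\mathscr P(L)$. Then ${\sim}{\sim}A=\{\pi_{\bigvee_{a\in A}a(1)}\}$.
   Context: An orthomodular lattice $(M,\le,{}^\perp)$ is a bounded lattice with a map ${}^\perp$ such that $m\wedge m^\perp=0$, $m\vee m^\perp=1$, $m\le n\Rightarrow n^\perp\le m^\perp$, $m^{\perp\perp}=m$, and $m\le n$ implies $n=m\vee(m^\perp\wedge n)$. The Sasaki projection onto $m$ is $\pi_m(x)=m\wedge(m^\perp\vee x)$. A map $f:M\to M$ is linear if there is $f^*:M\to M$ (necessarily unique) with $f(x)\le y^\perp\iff x\le(f^*(y))^\perp$ for all $x,y\in M$; $\mathbf{Lin}(\mathcal M)$ is the set of linear maps, an involutive monoid under composition $\circ$, involution $f\mapsto f^*$ and unit $\mathrm{id}_M$; every $\pi_m$ is linear with $\pi_m^*=\pi_m$. For such $L$, $\mathscr P(L)$ denotes the set of all subsets of $L$ with operations: union; $A\odot B=\{a\circ b:a\in A,b\in B\}$; $A^*=\{a^*:a\in A\}$; ${\sim}A=\{\pi_{(\bigvee_{a\in A}a(1))^\perp}\}$; unit $\{\mathrm{id}_M\}$. -}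

module Defs where

open import Level using (Level; suc; _⊔_) renaming (zero to 0ℓ)
open import Data.Product using (Σ; _×_; _,_; proj₁; proj₂)
open import Relation.Binary.PropositionalEquality using (_≡_)
open import Function using (_∘_; id; _⇔_)

record CompleteOML : Set₁ where
  infix 4 _≤_
  infixr 6 _∨_
  infixr 7 _∧_
  field
    Carrier : Set
    _≤_     : Carrier → Carrier → Set
    ≤-refl    : ∀ {x} → x ≤ x
    ≤-trans   : ∀ {x y z} → x ≤ y → y ≤ z → x ≤ z
    ≤-antisym : ∀ {x y} → x ≤ y → y ≤ x → x ≡ y
    _∧_ : Carrier → Carrier → Carrier
    _∨_ : Carrier → Carrier → Carrier
    ⊥ₘ  : Carrier
    ⊤ₘ  : Carrier
    ∧-lb₁ : ∀ x y → x ∧ y ≤ x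
    ∧-lb₂ : ∀ x y → x ∧ y ≤ y
    ∧-glb : ∀ {x y z} → z ≤ x → z ≤ y → z ≤ x ∧ y
    ∨-ub₁ : ∀ x y → x ≤ x ∨ y
    ∨-ub₂ : ∀ x y → y ≤ x ∨ y
    ∨-lub : ∀ {x y z} → x ≤ z → y ≤ z → x ∨ y ≤ z
    ⊥-min : ∀ x → ⊥ₘ ≤ x
    ⊤-max : ∀ x → x ≤ ⊤ₘ
    _ᗮ : Carrier → Carrier
    ∧-compl : ∀ m → m ∧ (m ᗮ) ≡ ⊥ₘ
    ∨-compl : ∀ m → m ∨ (m ᗮ) ≡ ⊤ₘ
    ᗮ-antitone : ∀ {m n} → m ≤ n → n ᗮ ≤ m ᗮ
    ᗮ-invol : ∀ m → (m ᗮ) ᗮ ≡ m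
    orthomodular : ∀ {m n} → m ≤ n → n ≡ m ∨ ((m ᗮ) ∧ n)
    ⋁ : {I : Set} → (I → Carrier) → Carrier
    ⋁-ub  : {I : Set} (f : I → Carrier) (i : I) → f i ≤ ⋁ f
    ⋁-lub : {I : Set} (f : I → Carrier) {z : Carrier} → (∀ i → f i ≤ z) → ⋁ f ≤ z

module _ (𝓜 : CompleteOML) where
  open CompleteOML 𝓜

  π : Carrier → Carrier → Carrier
  π m x = m ∧ ((m ᗮ) ∨ x)

  record IsLinear (f : Carrier → Carrier) : Set where
    field
      adj  : Carrier → Carrier
      adj-spec : ∀ x y → (f x ≤ y ᗮ) ⇔ (x ≤ (adj y) ᗮ)

  -- Subsets of maps M → M (predicates); equality of maps is pointwise.
  Subset : Set₁
  Subset = (Carrier → Carrier) → Set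

  record IsInvolutiveSubmonoidWithSasaki (L : Subset) : Set₁ where
    field
      linear   : ∀ f → L f → IsLinear f
      respects : ∀ f g → (∀ x → f x ≡ g x) → L f → L g
      id∈      : L id
      ∘∈       : ∀ f g → L f → L g → L (f ∘ g)
      *∈       : ∀ f (Lf : L f) → L (IsLinear.adj (linear f Lf))
      π∈       : ∀ m → L (π m)

  _⊆_ : Subset → Subset → Set
  A ⊆ B = ∀ f → A f → B f

  ｛_｝ : (Carrier → Carrier) → Subset
  ｛ h ｝ g = ∀ x → g x ≡ h x

  join1 : Subset → Carrier
  join1 A = ⋁ {Σ (Carrier → Carrier) A} (λ p → proj₁ p ⊤ₘ)

  ∼ : Subset → Subset
  ∼ A = ｛ π ((join1 A) ᗮ) ｝

  _≐_ : Subset → Subset → Set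
  A ≐ B = ∀ g → A g ⇔ B g

-- The join ⋁_{a ∈ {π_m}} a(1) of a singleton {π_m} is π_m(1) = m, so ∼A, being the
-- singleton {π_{(⋁A(1))ᗮ}}, has ⋁(∼A)(1) = (⋁A(1))ᗮ; applying ∼ once more and
-- cancelling the double orthocomplement gives {π_{⋁A(1)}}.
module Submission where

open import Defs
open import Data.Product using (_,_; proj₁; proj₂)
open import Relation.Binary.PropositionalEquality using (_≡_; refl; sym; trans; cong; subst)
open import Function using (_⇔_; mk⇔)

module _ (𝓜 : CompleteOML) where
  open CompleteOML 𝓜

  ∧-identityʳ : ∀ x → x ∧ ⊤ₘ ≡ x
  ∧-identityʳ x = ≤-antisym (∧-lb₁ x ⊤ₘ) (∧-glb ≤-refl (⊤-max x))

  ∨-zeroʳ : ∀ x → x ∨ ⊤ₘ ≡ ⊤ₘ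
  ∨-zeroʳ x = ≤-antisym (⊤-max _) (∨-ub₂ x ⊤ₘ)

  π-⊤ : ∀ m → π 𝓜 m ⊤ₘ ≡ m
  π-⊤ m = trans (cong (m ∧_) (∨-zeroʳ (m ᗮ))) (∧-identityʳ m)

  join1-｛｝ : ∀ h → join1 𝓜 (｛_｝ 𝓜 h) ≡ h ⊤ₘ
  join1-｛｝ h = ≤-antisym
    (⋁-lub _ (λ (g , g≗h) → subst (_≤ h ⊤ₘ) (sym (g≗h ⊤ₘ)) ≤-refl))
    (⋁-ub (λ p → proj₁ p ⊤ₘ) (h , λ _ → refl))

  join1-∼ : ∀ A → join1 𝓜 (∼ 𝓜 A) ≡ join1 𝓜 A ᗮ
  join1-∼ A = trans (join1-｛｝ (π 𝓜 (join1 𝓜 A ᗮ))) (π-⊤ (join1 𝓜 A ᗮ))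

  ｛｝-cong : ∀ {f h} → (∀ x → f x ≡ h x) → _≐_ 𝓜 (｛_｝ 𝓜 f) (｛_｝ 𝓜 h)
  ｛｝-cong f≗h g = mk⇔ (λ g≗f x → trans (g≗f x) (f≗h x))
                        (λ g≗h x → trans (g≗h x) (sym (f≗h x)))

  ∼∼-≐ : ∀ A → _≐_ 𝓜 (∼ 𝓜 (∼ 𝓜 A)) (｛_｝ 𝓜 (π 𝓜 (join1 𝓜 A)))
  ∼∼-≐ A = ｛｝-cong (λ x → cong (λ m → π 𝓜 m x) join1-∼∼)
    where
    join1-∼∼ : join1 𝓜 (∼ 𝓜 A) ᗮ ≡ join1 𝓜 A
    join1-∼∼ = trans (cong _ᗮ (join1-∼ A)) (ᗮ-invol (join1 𝓜 A))

-- The identity holds for every set A of maps.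
lemma3p8 : (𝓜 : CompleteOML) (L : Subset 𝓜) → IsInvolutiveSubmonoidWithSasaki 𝓜 L →
    (A : Subset 𝓜) → _⊆_ 𝓜 A L →
    _≐_ 𝓜 (∼ 𝓜 (∼ 𝓜 A)) (｛_｝ 𝓜 (π 𝓜 (join1 𝓜 A)))
lemma3p8 𝓜 _ _ A _ = ∼∼-≐ 𝓜 A
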